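{- Let $a_0 = 0$ and, for every positive integer $n$, $a_n := \sum_{k=0}^{n-1} k!\,(n-k-1)!$. Then for every natural number $n$, $$a_n = \frac{n!}{2^n} \sum_{k=1}^{n} \frac{2^k}{k}.$$
   Context: For $n = 0$ the sum on the right is empty and equals $0$. -}

module Defs where

open import Data.Nat using (ℕ; zero; suc; _+_; _*_; _∸_; _^_; _!)
open import Data.Nat.Properties using (_!≢0; m^n≢0)
open import Data.Integer using (+_)
open import Data.Rational using (ℚ; _/_; 0ℚ)
import Data.Rational as ℚ

sumℕ : ℕ → (ℕ → ℕ) → ℕ
sumℕ zero    f = 0
sumℕ (suc n) f = sumℕ n f + f n

-- a_n := Σ_{k=0}^{n-1} k! (n-k-1)!   (for n = 0 this is the empty sum 0 = a_0)
a : ℕ → ℕ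
a n = sumℕ n (λ k → k ! * (n ∸ k ∸ 1) !)

harmonic2 : ℕ → ℚ
harmonic2 zero    = 0ℚ
harmonic2 (suc k) = harmonic2 k ℚ.+ ((+ (2 ^ suc k)) / suc k)

rhs : ℕ → ℚ
rhs n = ((+ (n !)) / (2 ^ n)) {{m^n≢0 2 n}} ℚ.* harmonic2 n

-- Pairing the k-th term of a_{m+2} with the (k+1)-st gives
-- k!(m+1-k)! + (k+1)!(m-k)! = (m+2) k!(m-k)!, so adding the sum to itself
-- shifted by one yields the recurrence 2 a_{n+1} = (n+1) a_n + 2 n!.
-- In the form 2^{n+1} a_{n+1} / (n+1)! = 2^n a_n / n! + 2^{n+1} / (n+1)
-- this says that 2^n a_n / n! satisfies the recursion defining
-- Σ_{k=1}^{n} 2^k / k.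
module Submission where

open import Defs
open import Data.Nat as ℕ using (ℕ; zero; suc; _+_; _*_; _∸_; _^_; _!; _≤_; _<_; NonZero)
open import Data.Nat.Properties as ℕ
  using (_!≢0; m^n≢0; m*n≢0; ≤-refl; ≤-pred; m<n⇒m<1+n; n∸n≡0)
open import Data.Nat.Tactic.RingSolver using (solve-∀)
open import Data.Integer as ℤ using (+_)
import Data.Integer.Properties as ℤ
open import Data.Rational as ℚ using (_/_)
import Data.Rational.Properties as ℚ
import Data.Rational.Unnormalised as ℚᵘ
import Data.Rational.Unnormalised.Properties as ℚᵘ
open import Relation.Binary.PropositionalEquality
  using (_≡_; refl; sym; trans; cong; cong₂; module ≡-Reasoning)

sumℕ-cong : ∀ n {f g : ℕ → ℕ} → (∀ k → k < n → f k ≡ g k) → sumℕ n f ≡ sumℕ n g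
sumℕ-cong zero    f≗g = refl
sumℕ-cong (suc n) f≗g =
  cong₂ _+_ (sumℕ-cong n (λ k k<n → f≗g k (m<n⇒m<1+n k<n))) (f≗g n ≤-refl)

sumℕ-distrib-+ : ∀ n (f g : ℕ → ℕ) → sumℕ n (λ k → f k + g k) ≡ sumℕ n f + sumℕ n g
sumℕ-distrib-+ zero    f g = refl
sumℕ-distrib-+ (suc n) f g =
  trans (cong (λ s → s + (f n + g n)) (sumℕ-distrib-+ n f g))
        (+-interchange (sumℕ n f) (sumℕ n g) (f n) (g n))
  where
  +-interchange : ∀ w x y z → (w + x) + (y + z) ≡ (w + y) + (x + z)
  +-interchange = solve-∀

*-distribˡ-sumℕ : ∀ c n (f : ℕ → ℕ) → c * sumℕ n f ≡ sumℕ n (λ k → c * f k)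
*-distribˡ-sumℕ c zero    f = ℕ.*-zeroʳ c
*-distribˡ-sumℕ c (suc n) f =
  trans (ℕ.*-distribˡ-+ c (sumℕ n f) (f n)) (cong (_+ c * f n) (*-distribˡ-sumℕ c n f))

sumℕ-suc-head : ∀ n (f : ℕ → ℕ) → sumℕ (suc n) f ≡ f 0 + sumℕ n (λ k → f (suc k))
sumℕ-suc-head zero    f = ℕ.+-comm 0 (f 0)
sumℕ-suc-head (suc n) f =
  trans (cong (_+ f (suc n)) (sumℕ-suc-head n f)) (ℕ.+-assoc (f 0) _ _)

factorialConvolution : ℕ → ℕ
factorialConvolution n = sumℕ (suc n) (λ k → k ! * (n ∸ k) !)

a-suc : ∀ n → a (suc n) ≡ factorialConvolution n
a-suc n = sumℕ-cong (suc n) (λ k _ → cong (λ m → k ! * m !) (suc∸∸1 k))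
  where
  suc∸∸1 : ∀ k → suc n ∸ k ∸ 1 ≡ n ∸ k
  suc∸∸1 k = trans (ℕ.∸-+-assoc (suc n) k 1) (cong (suc n ∸_) (ℕ.+-comm k 1))

adjacent-terms : ∀ {m k} → k ≤ m →
  k ! * (suc m ∸ k) ! + suc k ! * (m ∸ k) ! ≡ suc (suc m) * (k ! * (m ∸ k) !)
adjacent-terms {m} {k} k≤m = begin
  k ! * (suc m ∸ k) ! + suc k ! * (m ∸ k) !
    ≡⟨ cong (λ d → k ! * d ! + suc k ! * (m ∸ k) !) (ℕ.+-∸-assoc 1 k≤m) ⟩
  k ! * (suc (m ∸ k) * (m ∸ k) !) + (suc k * k !) * (m ∸ k) !
    ≡⟨ factor (m ∸ k) k (k !) ((m ∸ k) !) ⟩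
  suc (suc ((m ∸ k) + k)) * (k ! * (m ∸ k) !)
    ≡⟨ cong (λ s → suc (suc s) * (k ! * (m ∸ k) !)) (ℕ.m∸n+n≡m k≤m) ⟩
  suc (suc m) * (k ! * (m ∸ k) !) ∎
  where
  open ≡-Reasoning
  factor : ∀ d k x y → x * (suc d * y) + (suc k * x) * y ≡ suc (suc (d + k)) * (x * y)
  factor = solve-∀

factorialConvolution-rec : ∀ m →
  2 * factorialConvolution (suc m) ≡ suc (suc m) * factorialConvolution m + 2 * suc m !
factorialConvolution-rec m = begin
  2 * C′                                       ≡⟨ double C′ ⟩
  C′ + C′                                      ≡⟨ cong₂ _+_ last-split first-split ⟩
  (L + f) + (f + R)                            ≡⟨ regroup L R f ⟩
  (L + R) + 2 * f                              ≡⟨ cong (_+ 2 * f) pair-up ⟩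
  suc (suc m) * factorialConvolution m + 2 * f ∎
  where
  open ≡-Reasoning
  t : ℕ → ℕ
  t k = k ! * (suc m ∸ k) !
  C′ = factorialConvolution (suc m)
  L = sumℕ (suc m) t
  R = sumℕ (suc m) (λ k → t (suc k))
  f = suc m !

  double : ∀ x → 2 * x ≡ x + x
  double = solve-∀
  regroup : ∀ l r f → (l + f) + (f + r) ≡ (l + r) + 2 * f
  regroup = solve-∀

  last-split : C′ ≡ L + f
  last-split = trans (cong (λ d → L + f * d !) (n∸n≡0 m)) (cong (λ x → L + x) (ℕ.*-identityʳ f))
  first-split : C′ ≡ f + R
  first-split = trans (sumℕ-suc-head (suc m) t) (cong (_+ R) (ℕ.*-identityˡ f))
  pair-up : L + R ≡ suc (suc m) * factorialConvolution m
  pair-up = begin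
    L + R                                    ≡⟨ sumℕ-distrib-+ (suc m) t (λ k → t (suc k)) ⟨
    sumℕ (suc m) (λ k → t k + t (suc k))     ≡⟨ sumℕ-cong (suc m) (λ k k<1+m → adjacent-terms (≤-pred k<1+m)) ⟩
    sumℕ (suc m) (λ k → suc (suc m) * (k ! * (m ∸ k) !))
                                             ≡⟨ *-distribˡ-sumℕ (suc (suc m)) (suc m) _ ⟨
    suc (suc m) * factorialConvolution m     ∎

a-rec : ∀ n → 2 * a (suc n) ≡ suc n * a n + 2 * n !
a-rec zero    = refl
a-rec (suc m) = begin
  2 * a (suc (suc m))
    ≡⟨ cong (2 *_) (a-suc (suc m)) ⟩
  2 * factorialConvolution (suc m)
    ≡⟨ factorialConvolution-rec m ⟩
  suc (suc m) * factorialConvolution m + 2 * suc m !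
    ≡⟨ cong (λ c → suc (suc m) * c + 2 * suc m !) (a-suc m) ⟨
  suc (suc m) * a (suc m) + 2 * suc m ! ∎
  where open ≡-Reasoning

2^n*a-rec : ∀ n → 2 ^ n * a n * suc n + 2 ^ suc n * n ! ≡ 2 ^ suc n * a (suc n)
2^n*a-rec n = begin
  2 ^ n * a n * suc n + 2 ^ suc n * n !  ≡⟨ factor-2^n (2 ^ n) (a n) (suc n) (n !) ⟩
  2 ^ n * (suc n * a n + 2 * n !)        ≡⟨ cong (2 ^ n *_) (a-rec n) ⟨
  2 ^ n * (2 * a (suc n))                ≡⟨ ℕ.*-assoc (2 ^ n) 2 (a (suc n)) ⟨
  2 ^ n * 2 * a (suc n)                  ≡⟨ cong (_* a (suc n)) (ℕ.*-comm (2 ^ n) 2) ⟩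
  2 ^ suc n * a (suc n)                  ∎
  where
  open ≡-Reasoning
  factor-2^n : ∀ p x s f → p * x * s + (2 * p) * f ≡ p * (s * x + 2 * f)
  factor-2^n = solve-∀

-- Fractions are compared in ℚᵘ, where _/_ does not normalise, and transported
-- back along the injective map toℚᵘ.
toℚᵘ-/ : ∀ i q .{{_ : NonZero q}} → ℚ.toℚᵘ (i / q) ℚᵘ.≃ i ℚᵘ./ q
toℚᵘ-/ i (suc q) = ℚ.toℚᵘ-fromℚᵘ (ℚᵘ.mkℚᵘ i q)

/-cross : ∀ p q p′ q′ .{{_ : NonZero q}} .{{_ : NonZero q′}} →
  p * q′ ≡ p′ * q → (+ p) ℚᵘ./ q ℚᵘ.≃ (+ p′) ℚᵘ./ q′
/-cross p q@(suc _) p′ q′@(suc _) eq =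
  ℚᵘ.*≡* (trans (sym (ℤ.pos-* p q′)) (trans (cong +_ eq) (ℤ.pos-* p′ q)))

/-+-/ : ∀ p q p′ q′ .{{_ : NonZero q}} .{{_ : NonZero q′}} →
  (+ p) ℚᵘ./ q ℚᵘ.+ (+ p′) ℚᵘ./ q′ ≡ ((+ (p * q′ + p′ * q)) ℚᵘ./ (q * q′)) {{m*n≢0 q q′}}
/-+-/ p q@(suc _) p′ q′@(suc _) = cong (ℚᵘ._/ (q * q′)) (sym
  (trans (ℤ.pos-+ (p * q′) (p′ * q)) (cong₂ ℤ._+_ (ℤ.pos-* p q′) (ℤ.pos-* p′ q))))

/-*-/ : ∀ p q p′ q′ .{{_ : NonZero q}} .{{_ : NonZero q′}} →
  (+ p) ℚᵘ./ q ℚᵘ.* ((+ p′) ℚᵘ./ q′) ≡ ((+ (p * p′)) ℚᵘ./ (q * q′)) {{m*n≢0 q q′}}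
/-*-/ p q@(suc _) p′ q′@(suc _) = cong (ℚᵘ._/ (q * q′)) (sym (ℤ.pos-* p p′))

toℚᵘ-harmonic2 : ∀ n → ℚ.toℚᵘ (harmonic2 n) ℚᵘ.≃ ((+ (2 ^ n * a n)) ℚᵘ./ n !) {{n !≢0}}
toℚᵘ-harmonic2 zero    = ℚᵘ.*≡* refl
toℚᵘ-harmonic2 (suc n) = begin
  ℚ.toℚᵘ (harmonic2 n ℚ.+ (+ (2 ^ suc n)) / suc n)
    ≈⟨ ℚ.toℚᵘ-homo-+ (harmonic2 n) ((+ (2 ^ suc n)) / suc n) ⟩
  ℚ.toℚᵘ (harmonic2 n) ℚᵘ.+ ℚ.toℚᵘ ((+ (2 ^ suc n)) / suc n)
    ≈⟨ ℚᵘ.+-cong (toℚᵘ-harmonic2 n) (toℚᵘ-/ (+ (2 ^ suc n)) (suc n)) ⟩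
  (+ (2 ^ n * a n)) ℚᵘ./ n ! ℚᵘ.+ (+ (2 ^ suc n)) ℚᵘ./ suc n
    ≡⟨ /-+-/ (2 ^ n * a n) (n !) (2 ^ suc n) (suc n) ⟩
  (+ (2 ^ n * a n * suc n + 2 ^ suc n * n !)) ℚᵘ./ (n ! * suc n)
    ≡⟨ ℚᵘ./-cong (cong +_ (2^n*a-rec n)) (ℕ.*-comm (n !) (suc n)) ⟩
  (+ (2 ^ suc n * a (suc n))) ℚᵘ./ suc n ! ∎
  where
  open ℚᵘ.≃-Reasoning
  instance
    n!≢0 : NonZero (n !)
    n!≢0 = n !≢0
    sucn!≢0 : NonZero (suc n !)
    sucn!≢0 = suc n !≢0
    n!*sucn≢0 : NonZero (n ! * suc n)
    n!*sucn≢0 = m*n≢0 (n !) (suc n)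

proposition1 : (n : ℕ) → (+ (a n)) / 1 ≡ rhs n
proposition1 n = ℚ.toℚᵘ-injective (begin
  ℚ.toℚᵘ ((+ (a n)) / 1)
    ≈⟨ toℚᵘ-/ (+ (a n)) 1 ⟩
  (+ (a n)) ℚᵘ./ 1
    ≈⟨ /-cross (a n) 1 (n ! * (2 ^ n * a n)) (2 ^ n * n !) (rearrange (a n) (2 ^ n) (n !)) ⟩
  (+ (n ! * (2 ^ n * a n))) ℚᵘ./ (2 ^ n * n !)
    ≡⟨ /-*-/ (n !) (2 ^ n) (2 ^ n * a n) (n !) ⟨
  (+ (n !)) ℚᵘ./ 2 ^ n ℚᵘ.* ((+ (2 ^ n * a n)) ℚᵘ./ n !)
    ≈⟨ ℚᵘ.*-cong (toℚᵘ-/ (+ (n !)) (2 ^ n)) (toℚᵘ-harmonic2 n) ⟨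
  ℚ.toℚᵘ ((+ (n !)) / 2 ^ n) ℚᵘ.* ℚ.toℚᵘ (harmonic2 n)
    ≈⟨ ℚ.toℚᵘ-homo-* ((+ (n !)) / 2 ^ n) (harmonic2 n) ⟨
  ℚ.toℚᵘ (rhs n) ∎)
  where
  open ℚᵘ.≃-Reasoning
  instance
    n!≢0 : NonZero (n !)
    n!≢0 = n !≢0
    2^n≢0 : NonZero (2 ^ n)
    2^n≢0 = m^n≢0 2 n
    2^n*n!≢0 : NonZero (2 ^ n * n !)
    2^n*n!≢0 = m*n≢0 (2 ^ n) (n !)
  rearrange : ∀ x p f → x * (p * f) ≡ f * (p * x) * 1
  rearrange = solve-∀
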